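{- Fix $p\in(0,1)$ and $n \ge 1$. Let $A_n(p)$ be the random set defined in the context below, so that $\mathrm{ZD}^{ -1}(A_n(p))$ is a random integer in $[0,F_{n+1})$. Let $m\in[0,F_{n+1})$ be an integer with Zeckendorf decomposition $m=F_{a_1}+\cdots+F_{a_k}$, where $k\ge 0$, $1\le a_1$, and $a_{j-1}+1<a_j$ for $2 \le j \le k$. Then $$\mathbb{P}\big(\mathrm{ZD}^{ -1}(A_n(p))=m\big)=\begin{cases}p^k(1-p)^{n-2k} & \text{if } m\in[0,F_n),\\ p^k(1-p)^{n-2k+1} & \text{if } m\in[F_n,F_{n+1}).\end{cases}$$
   Context: The Fibonacci numbers are normalized as $F_1=1$, $F_2=2$, $F_{n+1}=F_n+F_{n-1}$. Every nonnegative integer has a unique Zeckendorf decomposition as a sum of non-consecutive Fibonacci numbers, with $0$ corresponding to the empty sum. A finite set of Fibonacci numbers containing no two consecutive ones is a legal Zeckendorf decomposition. $\mathrm{ZD}^{ -1}$ maps such a set to the integer it represents, namely the sum of its elements. The random sets are built recursively. Let $A_0(p)=\emptyset$. For $n\ge1$: - if $F_{n-1}\in A_{n-1}(p)$, then $A_n(p)=A_{n-1}(p)$; - otherwise, $A_n(p)=A_{n-1}(p)\cup\{F_n\}$ with probability $p$, and $A_n(p)=A_{n-1}(p)$ with probability $1-p$. The random choices are independent, and $F_1$ is included with probability $p$.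
   Formalization: The parameter p ranges over the rational numbers in the interval (0,1). -}

module Defs where

open import Data.Nat using (ℕ; zero; suc; _+_; _≡ᵇ_)
open import Data.Bool using (Bool; true; false; if_then_else_; _∨_)
open import Data.List using (List; []; _∷_; concatMap; length)
open import Data.Product using (_×_; _,_)
open import Data.Rational using (ℚ; 0ℚ; 1ℚ) renaming (_+_ to _+ℚ_; _*_ to _*ℚ_; _-_ to _-ℚ_)

-- Fibonacci numbers normalised as F 1 = 1, F 2 = 2, F (n+1) = F n + F (n-1).
-- (F 0 = 1 is an auxiliary value, never used as a summand.)
F : ℕ → ℕ
F zero = 1
F (suc zero) = 1
F (suc (suc n)) = F (suc n) + F n

-- A set of Fibonacci numbers {F i | i ∈ S} is represented by the list S of its indices
-- (all indices ≥ 1; F is injective on indices ≥ 1, so this is faithful).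
ZD⁻¹ : List ℕ → ℕ
ZD⁻¹ [] = 0
ZD⁻¹ (i ∷ S) = F i + ZD⁻¹ S

_∈ᵇ_ : ℕ → List ℕ → Bool
i ∈ᵇ [] = false
i ∈ᵇ (j ∷ S) = (i ≡ᵇ j) ∨ (i ∈ᵇ S)

-- The distribution of the random set A n (p), as a finite list of
-- (outcome, probability) pairs (outcomes may repeat; probabilities add).  Step n ≥ 1: if F (n-1) ∈ A (n-1) then A n = A (n-1);
-- otherwise add F n with probability p, keep with probability 1 - p.
dist : ℚ → ℕ → List (List ℕ × ℚ)
dist p zero = (([] , 1ℚ) ∷ [])
dist p (suc n) = concatMap step (dist p n)
  where
  step : List ℕ × ℚ → List (List ℕ × ℚ)
  step (S , w) =
    if n ∈ᵇ S
    then ((S , w) ∷ [])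
    else (((suc n ∷ S) , (w *ℚ p)) ∷ (S , (w *ℚ (1ℚ -ℚ p))) ∷ [])

probZD : ℚ → ℕ → ℕ → ℚ
probZD p n m = go (dist p n)
  where
  go : List (List ℕ × ℚ) → ℚ
  go [] = 0ℚ
  go ((S , w) ∷ rest) = (if ZD⁻¹ S ≡ᵇ m then w else 0ℚ) +ℚ go rest

_^ℚ_ : ℚ → ℕ → ℚ
x ^ℚ zero = 1ℚ
x ^ℚ suc k = x *ℚ (x ^ℚ k)

data ZeckIdx : List ℕ → Set where
  z-nil  : ZeckIdx []
  z-one  : ∀ {a} → 1 Data.Nat.≤ a → ZeckIdx (a ∷ [])
  z-cons : ∀ {a b as} → 1 Data.Nat.≤ a → suc a Data.Nat.< b → ZeckIdx (b ∷ as) → ZeckIdx (a ∷ b ∷ as)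

{-# OPTIONS --safe #-}
-- F (n+1) can join A (n+1) exactly when F n ∉ A n, so splitting the expectation of any function
-- of A n according to whether F n ∈ A n gives a two-term recursion in n.  For the indicator of
-- ZD⁻¹ (A n) = m only one branch survives at each step: a set containing F n sums to at least
-- F n, a set avoiding it sums to less than F n.  Following the Zeckendorf decomposition of m from
-- its largest index downwards, each chosen index contributes a factor p and its successor is
-- blocked, while every other index up to n was free and not chosen, contributing 1 - p; this
-- gives (1 - p)^(n - 2k), with one blocked index fewer when F n itself is chosen.
module Submission where

open import Defs
open import Data.Nat using (ℕ; _≤_; _<_; _∸_; _*_; _+_)
open import Data.List using (List; length)
open import Data.Product using (_×_)
open import Data.Rational using (ℚ; 0ℚ; 1ℚ) renaming (_<_ to _<ℚ_; _*_ to _*ℚ_; _-_ to _-ℚ_)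
open import Relation.Binary.PropositionalEquality using (_≡_)

open import Data.Bool using (true; false; if_then_else_)
open import Data.Empty using (⊥-elim)
open import Data.List using ([]; _∷_; _++_; concatMap; reverse; reverseAcc)
open import Data.List.Properties using (length-reverse)
open import Data.List.Relation.Unary.All as All using (All; []; _∷_)
open import Data.Nat using (zero; suc; z≤n; s≤s; _≡ᵇ_)
import Data.Nat.Properties as ℕ
open import Data.Product using (Σ; _,_)
open import Data.Rational using () renaming (_+_ to _+ℚ_)
import Data.Rational.Properties as ℚ
open import Data.Rational.Solver using (module +-*-Solver)
open import Data.Sum using (inj₁; inj₂)
open import Relation.Binary.PropositionalEquality
  using (_≢_; _≗_; refl; sym; trans; cong; cong₂; subst; subst₂; module ≡-Reasoning)
open import Relation.Nullary.Decidable using (dec-true; dec-false)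

open +-*-Solver using (solve; _:=_; _:+_; _:*_; con)
open ≡-Reasoning

F-pos : ∀ n → 1 ≤ F n
F-pos zero = ℕ.≤-refl
F-pos (suc zero) = ℕ.≤-refl
F-pos (suc (suc n)) = ℕ.m≤n⇒m≤n+o (F n) (F-pos (suc n))

F-mono : ∀ {m n} → m ≤ n → F m ≤ F n
F-mono {n = n} z≤n = F-pos n
F-mono (s≤s {n = n} z≤n) = F-pos (suc n)
F-mono (s≤s m≤n@(s≤s m≤n′)) = ℕ.+-mono-≤ (F-mono m≤n) (F-mono m≤n′)

≡⇒≡ᵇ-true : ∀ {m n} → m ≡ n → (m ≡ᵇ n) ≡ true
≡⇒≡ᵇ-true {m} {n} = dec-true (m ℕ.≟ n)

≢⇒≡ᵇ-false : ∀ {m n} → m ≢ n → (m ≡ᵇ n) ≡ false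
≢⇒≡ᵇ-false {m} {n} = dec-false (m ℕ.≟ n)

+-cancelˡ-≡ᵇ : ∀ c x y → (c + x ≡ᵇ c + y) ≡ (x ≡ᵇ y)
+-cancelˡ-≡ᵇ zero x y = refl
+-cancelˡ-≡ᵇ (suc c) x y = +-cancelˡ-≡ᵇ c x y

∉ᵇ-above : ∀ {n S} → All (_< n) S → (n ∈ᵇ S) ≡ false
∉ᵇ-above [] = refl
∉ᵇ-above (j<n ∷ S<n) rewrite ≢⇒≡ᵇ-false (ℕ.>⇒≢ j<n) | ∉ᵇ-above S<n = refl

-- Zeckendorf index lists in decreasing order, indexed by their largest index; dist builds its
-- outcomes in this order.
data Zeck : ℕ → List ℕ → Set where
  [_]  : ∀ {t} → 1 ≤ t → Zeck t (t ∷ [])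
  cons : ∀ {s t a} → suc s < t → Zeck s a → Zeck t (t ∷ a)

F≤ZD⁻¹ : ∀ {t a} → Zeck t a → F t ≤ ZD⁻¹ a
F≤ZD⁻¹ [ _ ] = ℕ.m≤m+n _ _
F≤ZD⁻¹ (cons _ _) = ℕ.m≤m+n _ _

ZD⁻¹<F-suc : ∀ {t a} → Zeck t a → ZD⁻¹ a < F (suc t)
ZD⁻¹<F-suc {zero} [ () ]
ZD⁻¹<F-suc {zero} (cons () _)
ZD⁻¹<F-suc {suc t} [ _ ] = ℕ.+-monoʳ-< (F (suc t)) (F-pos t)
ZD⁻¹<F-suc {suc t} (cons (s≤s s<t) z) =
  ℕ.+-monoʳ-< (F (suc t)) (ℕ.<-≤-trans (ZD⁻¹<F-suc z) (F-mono s<t))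

Zeck-length : ∀ {t a} → Zeck t a → 2 * length a ≤ suc t
Zeck-length [ 1≤t ] = s≤s 1≤t
Zeck-length {t} {_ ∷ a} (cons s+1<t z) =
  subst (_≤ suc t) (sym (ℕ.*-suc 2 (length a))) (s≤s (ℕ.≤-trans (s≤s (Zeck-length z)) s+1<t))

reverse-Zeck : ∀ {x xs} → ZeckIdx (x ∷ xs) → Σ ℕ λ t → Zeck t (reverse (x ∷ xs))
reverse-Zeck (z-one 1≤x) = _ , [ 1≤x ]
reverse-Zeck (z-cons 1≤x x+1<y zi) = go zi (cons x+1<y [ 1≤x ])
  where
  go : ∀ {x xs acc} → ZeckIdx (x ∷ xs) → Zeck x (x ∷ acc) →
       Σ ℕ λ t → Zeck t (reverseAcc (x ∷ acc) xs)
  go (z-one _) z = _ , z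
  go (z-cons _ x+1<y zi) z = go zi (cons x+1<y z)

ZD⁻¹-reverseAcc : ∀ acc a → ZD⁻¹ (reverseAcc acc a) ≡ ZD⁻¹ a + ZD⁻¹ acc
ZD⁻¹-reverseAcc acc [] = refl
ZD⁻¹-reverseAcc acc (i ∷ a) = begin
  ZD⁻¹ (reverseAcc (i ∷ acc) a) ≡⟨ ZD⁻¹-reverseAcc (i ∷ acc) a ⟩
  ZD⁻¹ a + (F i + ZD⁻¹ acc)     ≡⟨ sym (ℕ.+-assoc (ZD⁻¹ a) (F i) (ZD⁻¹ acc)) ⟩
  ZD⁻¹ a + F i + ZD⁻¹ acc       ≡⟨ cong (_+ ZD⁻¹ acc) (ℕ.+-comm (ZD⁻¹ a) (F i)) ⟩
  F i + ZD⁻¹ a + ZD⁻¹ acc       ∎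

ZD⁻¹-reverse : ∀ a → ZD⁻¹ (reverse a) ≡ ZD⁻¹ a
ZD⁻¹-reverse a = trans (ZD⁻¹-reverseAcc [] a) (ℕ.+-identityʳ (ZD⁻¹ a))

expect : (List ℕ → ℚ) → List (List ℕ × ℚ) → ℚ
expect g [] = 0ℚ
expect g ((S , w) ∷ L) = w *ℚ g S +ℚ expect g L

expect-++ : ∀ g L L′ → expect g (L ++ L′) ≡ expect g L +ℚ expect g L′
expect-++ g [] L′ = sym (ℚ.+-identityˡ (expect g L′))
expect-++ g ((S , w) ∷ L) L′ = begin
  w *ℚ g S +ℚ expect g (L ++ L′)           ≡⟨ cong (w *ℚ g S +ℚ_) (expect-++ g L L′) ⟩
  w *ℚ g S +ℚ (expect g L +ℚ expect g L′)  ≡⟨ sym (ℚ.+-assoc (w *ℚ g S) _ _) ⟩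
  w *ℚ g S +ℚ expect g L +ℚ expect g L′    ∎

𝟙[ZD⁻¹≡_] : ℕ → List ℕ → ℚ
𝟙[ZD⁻¹≡ m ] S = if ZD⁻¹ S ≡ᵇ m then 1ℚ else 0ℚ

𝟙-∷-+ : ∀ i x → (λ S → 𝟙[ZD⁻¹≡ F i + x ] (i ∷ S)) ≗ 𝟙[ZD⁻¹≡ x ]
𝟙-∷-+ i x S rewrite +-cancelˡ-≡ᵇ (F i) (ZD⁻¹ S) x = refl

𝟙-∷-< : ∀ {i m} → m < F i → (λ S → 𝟙[ZD⁻¹≡ m ] (i ∷ S)) ≗ (λ _ → 0ℚ)
𝟙-∷-< {i} m<Fi S
  rewrite ≢⇒≡ᵇ-false (ℕ.>⇒≢ (ℕ.<-≤-trans m<Fi (ℕ.m≤m+n (F i) (ZD⁻¹ S)))) = refl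

if-then-else-0 : ∀ b w → (if b then w else 0ℚ) ≡ w *ℚ (if b then 1ℚ else 0ℚ)
if-then-else-0 true w = sym (ℚ.*-identityʳ w)
if-then-else-0 false w = sym (ℚ.*-zeroʳ w)

expect-𝟙-unique : ∀ m (G : List (List ℕ × ℚ) → ℚ) → G [] ≡ 0ℚ →
  (∀ S w L → G ((S , w) ∷ L) ≡ (if ZD⁻¹ S ≡ᵇ m then w else 0ℚ) +ℚ G L) →
  ∀ L → G L ≡ expect 𝟙[ZD⁻¹≡ m ] L
expect-𝟙-unique m G G[] G∷ [] = G[]
expect-𝟙-unique m G G[] G∷ ((S , w) ∷ L) =
  trans (G∷ S w L) (cong₂ _+ℚ_ (if-then-else-0 (ZD⁻¹ S ≡ᵇ m) w) (expect-𝟙-unique m G G[] G∷ L))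

module _ (p : ℚ) where

  q : ℚ
  q = 1ℚ -ℚ p

  weight : ℕ → ℕ → ℚ
  weight k n = (p ^ℚ k) *ℚ (q ^ℚ (n ∸ 2 * k))

  weight-suc : ∀ k n → 2 * k ≤ n → q *ℚ weight k n ≡ weight k (suc n)
  weight-suc k n 2k≤n = begin
    q *ℚ ((p ^ℚ k) *ℚ (q ^ℚ (n ∸ 2 * k)))
      ≡⟨ solve 3 (λ q x y → q :* (x :* y) := x :* (q :* y)) refl q (p ^ℚ k) _ ⟩
    (p ^ℚ k) *ℚ (q ^ℚ suc (n ∸ 2 * k))
      ≡⟨ cong (λ e → (p ^ℚ k) *ℚ (q ^ℚ e)) (sym (ℕ.+-∸-assoc 1 2k≤n)) ⟩
    weight k (suc n)
      ∎

  weight-cons : ∀ k n → p *ℚ weight k n ≡ weight (suc k) (suc (suc n))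
  weight-cons k n = begin
    p *ℚ ((p ^ℚ k) *ℚ (q ^ℚ (n ∸ 2 * k)))
      ≡⟨ sym (ℚ.*-assoc p (p ^ℚ k) _) ⟩
    (p ^ℚ suc k) *ℚ (q ^ℚ (suc (suc n) ∸ suc (suc (2 * k))))
      ≡⟨ cong (λ e → (p ^ℚ suc k) *ℚ (q ^ℚ (suc (suc n) ∸ e))) (sym (ℕ.*-suc 2 k)) ⟩
    weight (suc k) (suc (suc n))
      ∎

  -- E⁺ n g and E⁻ n g are the contributions to the expectation of g (A n) of the events
  -- F n ∈ A n and F n ∉ A n.
  E⁺ E⁻ : ℕ → (List ℕ → ℚ) → ℚ
  E⁺ zero g = 0ℚ
  E⁺ (suc n) g = p *ℚ E⁻ n (λ S → g (suc n ∷ S))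
  E⁻ zero g = g []
  E⁻ (suc n) g = E⁺ n g +ℚ q *ℚ E⁻ n g

  E⁻-cong : ∀ n {g g′} → (∀ {S} → All (_< n) S → g S ≡ g′ S) → E⁻ n g ≡ E⁻ n g′
  E⁺-cong : ∀ n {g g′} → (∀ {S} → All (_< suc n) S → g S ≡ g′ S) → E⁺ n g ≡ E⁺ n g′
  E⁻-cong zero g≡g′ = g≡g′ []
  E⁻-cong (suc n) g≡g′ =
    cong₂ _+ℚ_ (E⁺-cong n g≡g′)
      (cong (q *ℚ_) (E⁻-cong n (λ S<n → g≡g′ (All.map ℕ.m<n⇒m<1+n S<n))))
  E⁺-cong zero g≡g′ = refl
  E⁺-cong (suc n) g≡g′ =
    cong (p *ℚ_) (E⁻-cong n (λ S<n →
      g≡g′ (ℕ.n<1+n (suc n) ∷ All.map (λ j<n → ℕ.m<n⇒m<1+n (ℕ.m<n⇒m<1+n j<n)) S<n)))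

  E⁻-ext : ∀ n {g g′} → g ≗ g′ → E⁻ n g ≡ E⁻ n g′
  E⁻-ext n g≗g′ = E⁻-cong n (λ {S} _ → g≗g′ S)

  E⁻-linear : ∀ n a b g h → E⁻ n (λ S → a *ℚ g S +ℚ b *ℚ h S) ≡ a *ℚ E⁻ n g +ℚ b *ℚ E⁻ n h
  E⁺-linear : ∀ n a b g h → E⁺ n (λ S → a *ℚ g S +ℚ b *ℚ h S) ≡ a *ℚ E⁺ n g +ℚ b *ℚ E⁺ n h
  E⁻-linear zero a b g h = refl
  E⁻-linear (suc n) a b g h rewrite E⁺-linear n a b g h | E⁻-linear n a b g h =
    solve 7 (λ a b q x y z w → (a :* x :+ b :* y) :+ q :* (a :* z :+ b :* w)
                              := a :* (x :+ q :* z) :+ b :* (y :+ q :* w))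
      refl a b q (E⁺ n g) (E⁺ n h) (E⁻ n g) (E⁻ n h)
  E⁺-linear zero a b g h = solve 2 (λ a b → con 0ℚ := a :* con 0ℚ :+ b :* con 0ℚ) refl a b
  E⁺-linear (suc n) a b g h rewrite E⁻-linear n a b (λ S → g (suc n ∷ S)) (λ S → h (suc n ∷ S)) =
    solve 5 (λ p a b x y → p :* (a :* x :+ b :* y) := a :* (p :* x) :+ b :* (p :* y))
      refl p a b (E⁻ n (λ S → g (suc n ∷ S))) (E⁻ n (λ S → h (suc n ∷ S)))

  E⁻-suc-when-E⁺≡0 : ∀ n {g} → E⁺ n g ≡ 0ℚ → E⁻ (suc n) g ≡ q *ℚ E⁻ n g
  E⁻-suc-when-E⁺≡0 n {g} E⁺≡0 = trans (cong (_+ℚ q *ℚ E⁻ n g) E⁺≡0) (ℚ.+-identityˡ _)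

  E⁻-suc-when-E⁻≡0 : ∀ n {g} → E⁻ n g ≡ 0ℚ → E⁻ (suc n) g ≡ E⁺ n g
  E⁻-suc-when-E⁻≡0 n {g} E⁻≡0 =
    trans (cong (λ e → E⁺ n g +ℚ q *ℚ e) E⁻≡0)
      (trans (cong (E⁺ n g +ℚ_) (ℚ.*-zeroʳ q)) (ℚ.+-identityʳ _))

  E⁻-zero : ∀ n → E⁻ n (λ _ → 0ℚ) ≡ 0ℚ
  E⁺-zero : ∀ n → E⁺ n (λ _ → 0ℚ) ≡ 0ℚ
  E⁻-zero zero = refl
  E⁻-zero (suc n) =
    trans (E⁻-suc-when-E⁺≡0 n (E⁺-zero n)) (trans (cong (q *ℚ_) (E⁻-zero n)) (ℚ.*-zeroʳ q))
  E⁺-zero zero = refl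
  E⁺-zero (suc n) = trans (cong (p *ℚ_) (E⁻-zero n)) (ℚ.*-zeroʳ p)

  -- The step function of dist, which is local to its definition in Defs.
  extend : ℕ → List ℕ × ℚ → List (List ℕ × ℚ)
  extend n (S , w) = if n ∈ᵇ S then (S , w) ∷ [] else (suc n ∷ S , w *ℚ p) ∷ (S , w *ℚ q) ∷ []

  stepMean : ℕ → (List ℕ → ℚ) → List ℕ → ℚ
  stepMean n g S = if n ∈ᵇ S then g S else p *ℚ g (suc n ∷ S) +ℚ q *ℚ g S

  expect-extend : ∀ n g S w → expect g (extend n (S , w)) ≡ w *ℚ stepMean n g S
  expect-extend n g S w with n ∈ᵇ S
  ... | true = ℚ.+-identityʳ (w *ℚ g S)
  ... | false =
    solve 5 (λ w p q x y → w :* p :* x :+ (w :* q :* y :+ con 0ℚ) := w :* (p :* x :+ q :* y))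
      refl w p q (g (suc n ∷ S)) (g S)

  expect-concatMap-extend : ∀ n g L → expect g (concatMap (extend n) L) ≡ expect (stepMean n g) L
  expect-concatMap-extend n g [] = refl
  expect-concatMap-extend n g ((S , w) ∷ L) =
    trans (expect-++ g (extend n (S , w)) (concatMap (extend n) L))
      (cong₂ _+ℚ_ (expect-extend n g S w) (expect-concatMap-extend n g L))

  E⁺-stepMean : ∀ n g → E⁺ n (stepMean n g) ≡ E⁺ n g
  E⁺-stepMean zero g = refl
  E⁺-stepMean (suc n) g = cong (p *ℚ_) (E⁻-ext n chosen)
    where
    chosen : ∀ S → stepMean (suc n) g (suc n ∷ S) ≡ g (suc n ∷ S)
    chosen S rewrite ≡⇒≡ᵇ-true {n} refl = refl

  E⁻-stepMean : ∀ n g → E⁻ n (stepMean n g) ≡ p *ℚ E⁻ n (λ S → g (suc n ∷ S)) +ℚ q *ℚ E⁻ n g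
  E⁻-stepMean n g = trans (E⁻-cong n free) (E⁻-linear n p q (λ S → g (suc n ∷ S)) g)
    where
    free : ∀ {S} → All (_< n) S → stepMean n g S ≡ p *ℚ g (suc n ∷ S) +ℚ q *ℚ g S
    free S<n rewrite ∉ᵇ-above S<n = refl

  expect-dist : ∀ n g → expect g (dist p n) ≡ E⁺ n g +ℚ E⁻ n g
  expect-dist zero g = solve 1 (λ x → con 1ℚ :* x :+ con 0ℚ := con 0ℚ :+ x) refl (g [])
  expect-dist (suc n) g = begin
    expect g (dist p (suc n))
      ≡⟨ expect-concatMap-extend n g (dist p n) ⟩
    expect (stepMean n g) (dist p n)
      ≡⟨ expect-dist n (stepMean n g) ⟩
    E⁺ n (stepMean n g) +ℚ E⁻ n (stepMean n g)
      ≡⟨ cong₂ _+ℚ_ (E⁺-stepMean n g) (E⁻-stepMean n g) ⟩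
    E⁺ n g +ℚ (p *ℚ E⁻ n g⁺ +ℚ q *ℚ E⁻ n g)
      ≡⟨ solve 5 (λ p q x y z → x :+ (p :* y :+ q :* z) := p :* y :+ (x :+ q :* z))
           refl p q (E⁺ n g) (E⁻ n g⁺) (E⁻ n g) ⟩
    p *ℚ E⁻ n g⁺ +ℚ (E⁺ n g +ℚ q *ℚ E⁻ n g)
      ∎
    where
    g⁺ : List ℕ → ℚ
    g⁺ S = g (suc n ∷ S)

  -- probZD sums over dist p n with a loop local to its definition; abstracting dist p n lets
  -- unification identify that loop with G in expect-𝟙-unique.
  probZD-split : ∀ n m → probZD p n m ≡ E⁺ n 𝟙[ZD⁻¹≡ m ] +ℚ E⁻ n 𝟙[ZD⁻¹≡ m ]
  probZD-split n m = trans (probZD≡expect n) (expect-dist n 𝟙[ZD⁻¹≡ m ])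
    where
    probZD≡expect : ∀ n → probZD p n m ≡ expect 𝟙[ZD⁻¹≡ m ] (dist p n)
    probZD≡expect n with dist p n | expect-𝟙-unique m _ refl (λ _ _ _ → refl)
    ... | L | unique = unique L

  E⁺-below : ∀ n {m} → m < F n → E⁺ n 𝟙[ZD⁻¹≡ m ] ≡ 0ℚ
  E⁺-below zero _ = refl
  E⁺-below (suc n) m<F =
    trans (cong (p *ℚ_) (trans (E⁻-ext n (𝟙-∷-< {suc n} m<F)) (E⁻-zero n))) (ℚ.*-zeroʳ p)

  E⁻-above : ∀ n {m} → F n ≤ m → E⁻ n 𝟙[ZD⁻¹≡ m ] ≡ 0ℚ
  E⁺-above : ∀ n {m} → F (suc n) ≤ m → E⁺ n 𝟙[ZD⁻¹≡ m ] ≡ 0ℚ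
  E⁻-above zero {suc m} _ = refl
  E⁻-above (suc n) F≤m =
    trans (E⁻-suc-when-E⁻≡0 n (E⁻-above n (ℕ.≤-trans (F-mono (ℕ.n≤1+n n)) F≤m))) (E⁺-above n F≤m)
  E⁺-above zero _ = refl
  E⁺-above (suc n) F≤m with ℕ.m≤n⇒∃[o]m+o≡n (ℕ.≤-trans (ℕ.m≤m+n (F (suc n)) (F n)) F≤m)
  ... | x , refl =
    trans (cong (p *ℚ_) (trans (E⁻-ext n (𝟙-∷-+ (suc n) x)) (E⁻-above n Fn≤x))) (ℚ.*-zeroʳ p)
    where
    Fn≤x : F n ≤ x
    Fn≤x = ℕ.+-cancelˡ-≤ (F (suc n)) _ _ F≤m

  E⁻-empty : ∀ n → E⁻ n 𝟙[ZD⁻¹≡ 0 ] ≡ q ^ℚ n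
  E⁻-empty zero = refl
  E⁻-empty (suc n) = trans (E⁻-suc-when-E⁺≡0 n (E⁺-below n (F-pos n))) (cong (q *ℚ_) (E⁻-empty n))

  E⁻-Zeck : ∀ n {t a} → Zeck t a → t < n → E⁻ n 𝟙[ZD⁻¹≡ ZD⁻¹ a ] ≡ weight (length a) n
  E⁺-Zeck : ∀ {n a} → Zeck n a → E⁺ n 𝟙[ZD⁻¹≡ ZD⁻¹ a ] ≡ weight (length a) (suc n)
  E⁻-Zeck (suc n) {t} {a} z (s≤s t≤n) with ℕ.m≤n⇒m<n∨m≡n t≤n
  ... | inj₁ t<n = begin
    E⁻ (suc n) 𝟙[ZD⁻¹≡ ZD⁻¹ a ]
      ≡⟨ E⁻-suc-when-E⁺≡0 n (E⁺-below n (ℕ.<-≤-trans (ZD⁻¹<F-suc z) (F-mono t<n))) ⟩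
    q *ℚ E⁻ n 𝟙[ZD⁻¹≡ ZD⁻¹ a ]
      ≡⟨ cong (q *ℚ_) (E⁻-Zeck n z t<n) ⟩
    q *ℚ weight (length a) n
      ≡⟨ weight-suc (length a) n (ℕ.≤-trans (Zeck-length z) t<n) ⟩
    weight (length a) (suc n)
      ∎
  ... | inj₂ refl = trans (E⁻-suc-when-E⁻≡0 t (E⁻-above t (F≤ZD⁻¹ z))) (E⁺-Zeck z)
  E⁺-Zeck {suc n} [ _ ] = begin
    p *ℚ E⁻ n (λ S → 𝟙[ZD⁻¹≡ F (suc n) + 0 ] (suc n ∷ S))
      ≡⟨ cong (p *ℚ_) (E⁻-ext n (𝟙-∷-+ (suc n) 0)) ⟩
    p *ℚ E⁻ n 𝟙[ZD⁻¹≡ 0 ]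
      ≡⟨ cong (p *ℚ_) (trans (E⁻-empty n) (sym (ℚ.*-identityˡ _))) ⟩
    p *ℚ weight 0 n
      ≡⟨ weight-cons 0 n ⟩
    weight 1 (suc (suc n))
      ∎
  E⁺-Zeck {suc n} {_ ∷ a} (cons (s≤s s<n) z) = begin
    p *ℚ E⁻ n (λ S → 𝟙[ZD⁻¹≡ F (suc n) + ZD⁻¹ a ] (suc n ∷ S))
      ≡⟨ cong (p *ℚ_) (E⁻-ext n (𝟙-∷-+ (suc n) (ZD⁻¹ a))) ⟩
    p *ℚ E⁻ n 𝟙[ZD⁻¹≡ ZD⁻¹ a ]
      ≡⟨ cong (p *ℚ_) (E⁻-Zeck n z s<n) ⟩
    p *ℚ weight (length a) n
      ≡⟨ weight-cons (length a) n ⟩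
    weight (suc (length a)) (suc (suc n))
      ∎

  ProbFormula : ℕ → ℕ → ℕ → Set
  ProbFormula n m k =
    (m < F n → probZD p n m ≡ weight k n) × (F n ≤ m → probZD p n m ≡ weight k (suc n))

  probFormula-empty : ∀ n → ProbFormula n 0 0
  probFormula-empty n = (λ _ → empty) , λ Fn≤0 → ⊥-elim (ℕ.<⇒≱ (F-pos n) Fn≤0)
    where
    empty : probZD p n 0 ≡ weight 0 n
    empty = begin
      probZD p n 0                          ≡⟨ probZD-split n 0 ⟩
      E⁺ n 𝟙[ZD⁻¹≡ 0 ] +ℚ E⁻ n 𝟙[ZD⁻¹≡ 0 ]  ≡⟨ cong₂ _+ℚ_ (E⁺-below n (F-pos n)) (E⁻-empty n) ⟩
      0ℚ +ℚ q ^ℚ n                          ≡⟨ ℚ.+-identityˡ _ ⟩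
      q ^ℚ n                                ≡⟨ sym (ℚ.*-identityˡ _) ⟩
      weight 0 n                            ∎

  probFormula-Zeck : ∀ n {t a} → Zeck t a → ZD⁻¹ a < F (suc n) → ProbFormula n (ZD⁻¹ a) (length a)
  probFormula-Zeck n {t} {a} z m<F with ℕ.m≤n⇒m<n∨m≡n t≤n
    where
    t≤n : t ≤ n
    t≤n = ℕ.≮⇒≥ (λ n<t → ℕ.<⇒≱ m<F (ℕ.≤-trans (F-mono n<t) (F≤ZD⁻¹ z)))
  ... | inj₁ t<n = (λ _ → below) , λ Fn≤m → ⊥-elim (ℕ.<⇒≱ m<Fn Fn≤m)
    where
    m<Fn : ZD⁻¹ a < F n
    m<Fn = ℕ.<-≤-trans (ZD⁻¹<F-suc z) (F-mono t<n)
    below : probZD p n (ZD⁻¹ a) ≡ weight (length a) n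
    below = trans (probZD-split n _)
      (trans (cong₂ _+ℚ_ (E⁺-below n m<Fn) (E⁻-Zeck n z t<n)) (ℚ.+-identityˡ _))
  ... | inj₂ refl = (λ m<Fn → ⊥-elim (ℕ.<⇒≱ m<Fn (F≤ZD⁻¹ z))) , λ _ → top
    where
    top : probZD p t (ZD⁻¹ a) ≡ weight (length a) (suc t)
    top = trans (probZD-split t _)
      (trans (cong₂ _+ℚ_ (E⁺-Zeck z) (E⁻-above t (F≤ZD⁻¹ z))) (ℚ.+-identityʳ _))

lemma2p1 : (p : ℚ) → 0ℚ <ℚ p → p <ℚ 1ℚ → (n : ℕ) → 1 ≤ n →
    (m : ℕ) → m < F (n + 1) → (a : List ℕ) → ZeckIdx a → ZD⁻¹ a ≡ m →
    (m < F n → probZD p n m ≡ (p ^ℚ length a) *ℚ ((1ℚ -ℚ p) ^ℚ (n ∸ 2 * length a)))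
    × (F n ≤ m → probZD p n m ≡ (p ^ℚ length a) *ℚ ((1ℚ -ℚ p) ^ℚ (n + 1 ∸ 2 * length a)))
lemma2p1 p _ _ n _ _ _ [] _ refl rewrite ℕ.+-comm n 1 = probFormula-empty p n
lemma2p1 p _ _ n _ _ m<F a@(_ ∷ _) zi refl rewrite ℕ.+-comm n 1 with reverse-Zeck zi
... | _ , z = subst₂ (ProbFormula p n) (ZD⁻¹-reverse a) (length-reverse a)
                (probFormula-Zeck p n z (subst (_< F (suc n)) (sym (ZD⁻¹-reverse a)) m<F))
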